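{- Let $T$ be a rooted tree with root $r$, and let $\{I(u) : u\in V(T)\}$ be a family of pairwise distinct intervals (one for each node). Suppose that every non-root node $u$ satisfies $I(u)\subseteq I(\operatorname{sp}(u))\cap I(\operatorname{sp}(\operatorname{parent}(u)))$. Then for every light node $u$ and every descendant $v$ of $u$, we have $I(v)\subset I(u)$.
   Context: For integers $a\le b$, the interval $[a,b]$ is the set of integers $\{a,a+1,\dots,b\}$. In a rooted tree, $u$ is an ancestor of $v$ if $u\ne v$ and $u$ lies on the path from $v$ to the root; $v$ is then a descendant of $u$; $\operatorname{parent}(u)$ is the ancestor of $u$ at distance $1$. The weight of a node is the number of nodes in the subtree rooted at it (including itself). For each non-leaf node $u$, among the children of $u$ of maximum weight exactly one is chosen (arbitrarily) and called heavy; all other nodes, including the root, are called light. The supervisor $\operatorname{sp}(u)$ of a node $u$ is the light node of largest depth on the path from $u$ to the root (so $\operatorname{sp}(u)=u$ if $u$ is light). -}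

module Defs where

open import Level using (0ℓ)
open import Data.Nat as ℕ using (ℕ; zero; suc)
open import Data.Fin using (Fin; _≟_; toℕ)
open import Data.List using (List; length; filter; allFin)
open import Data.List.Relation.Unary.Any using (Any; any?)
open import Data.Integer as ℤ using (ℤ)
open import Data.Product using (Σ; ∃; _×_; _,_; proj₁; proj₂)
open import Relation.Nullary using (¬_)
open import Relation.Binary.PropositionalEquality using (_≡_; _≢_)
open import Relation.Unary using (Pred; Decidable)

iter : ∀ {A : Set} → (A → A) → ℕ → A → A
iter f zero    x = x
iter f (suc k) x = f (iter f k x)

-- Convention: parent root ≡ root (the value is irrelevant; the root has no parent).
-- Every node reaches the root by iterating parent; together with
-- parent root ≡ root this says exactly that the functional graph is a tree rooted at root.
record RootedTree (n : ℕ) : Set where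
  field
    parent       : Fin n → Fin n
    root         : Fin n
    parent-root  : parent root ≡ root
    reaches-root : ∀ u → ∃ λ k → iter parent k u ≡ root

  Ancestor : Fin n → Fin n → Set
  Ancestor u v = u ≢ v × ∃ λ k → iter parent k v ≡ u

  Descendant : Fin n → Fin n → Set
  Descendant v u = Ancestor u v

  Child : Fin n → Fin n → Set
  Child c u = c ≢ root × parent c ≡ u

  -- v is in the subtree rooted at u (v = u or v a descendant of u).
  -- Searching k ≤ n suffices since every node has depth < n.
  InSubtree : Fin n → Fin n → Set
  InSubtree u v = Any (λ (k : Fin (suc n)) → iter parent (toℕ k) v ≡ u) (allFin (suc n))

  inSubtree? : ∀ u → Decidable (InSubtree u)
  inSubtree? u v = any? (λ k → iter parent (toℕ k) v ≟ u) (allFin (suc n))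

  weight : Fin n → ℕ
  weight u = length (filter (inSubtree? u) (allFin n))

record HeavyChoice {n : ℕ} (T : RootedTree n) : Set₁ where
  open RootedTree T
  field
    Heavy        : Pred (Fin n) 0ℓ
    heavy-child  : ∀ c → Heavy c → c ≢ root
    heavy-max    : ∀ c → Heavy c → ∀ c′ → Child c′ (parent c) → weight c′ ℕ.≤ weight c
    heavy-exists : ∀ u → (∃ λ c → Child c u) → ∃ λ c → Child c u × Heavy c
    heavy-unique : ∀ c c′ → Heavy c → Heavy c′ → parent c ≡ parent c′ → c ≡ c′

  Light : Pred (Fin n) 0ℓ
  Light u = ¬ Heavy u

  IsSp : Fin n → Fin n → Set
  IsSp u s = ∃ λ k → iter parent k u ≡ s × Light s
                   × (∀ j → j ℕ.< k → Heavy (iter parent j u))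

⟦_,_⟧ : ℤ → ℤ → Pred ℤ 0ℓ
⟦ a , b ⟧ x = a ℤ.≤ x × x ℤ.≤ b

⟪_⟫ : ℤ × ℤ → Pred ℤ 0ℓ
⟪ p ⟫ = ⟦ proj₁ p , proj₂ p ⟧

module Submission where

-- Fix a light node u.  Walk from a descendant w of u up to u.
-- If w is not the root, its parent's supervisor s′ = sp(parent w) lies on the
-- path from parent w to u: the path climbs through heavy nodes until it meets
-- the first light one, and u itself is light, so s′ is reached no later than u.
-- The hypothesis gives I(w) ⊆ I(s′), and s′ is strictly closer to u than w,
-- so strong induction on the distance to u yields I(w) ⊆ I(u).  For v ≠ u the
-- inclusion is strict because distinct nodes carry distinct intervals.
--
-- Heaviness is not decidable, so the supervisor is only shown to exist in the
-- double-negation monad; this is harmless since the goal, membership of an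
-- integer in an interval, is decidable and hence stable under ¬¬.

open import Defs
open import Data.Nat using (ℕ; zero; suc; _≤_; _<_; z≤n; s≤s)
open import Data.Nat.Induction using (<-rec)
open import Data.Nat.Properties using (m≤n⇒m≤1+n; ≤-refl)
open import Data.Fin using (Fin; _≟_)
open import Data.Integer using (ℤ; _≤?_) renaming (_≤_ to _≤ℤ_)
open import Data.Product using (_×_; _,_; proj₁; proj₂; ∃₂)
open import Relation.Nullary using (¬_; Dec; yes; no)
open import Relation.Nullary.Decidable using (decidable-stable; _×-dec_; ¬¬-excluded-middle)
open import Relation.Binary.PropositionalEquality using (_≡_; _≢_; refl; sym; trans; cong; subst)
open import Relation.Unary using (Pred; _⊆_; _⊂_; _∩_)

iter-suc : ∀ {A : Set} (f : A → A) k x → iter f (suc k) x ≡ iter f k (f x)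
iter-suc f zero    x = refl
iter-suc f (suc k) x = cong f (iter-suc f k x)

iter-fixed : ∀ {A : Set} (f : A → A) r → f r ≡ r → ∀ k → iter f k r ≡ r
iter-fixed f r fr≡r zero    = refl
iter-fixed f r fr≡r (suc k) = trans (cong f (iter-fixed f r fr≡r k)) fr≡r

interval? : ∀ (p : ℤ × ℤ) x → Dec (⟪ p ⟫ x)
interval? (a , b) x = (a ≤? x) ×-dec (x ≤? b)

module Supervisor {n : ℕ} (T : RootedTree n) (H : HeavyChoice T) where
  open RootedTree T
  open HeavyChoice H

  sp-of-heavy : ∀ {p s} → Heavy p → IsSp (parent p) s → IsSp p s
  sp-of-heavy {p} hp (j , p↑j≡s , ls , below) =
    suc j , trans (iter-suc parent j p) p↑j≡s , ls , heavy-below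
    where
    heavy-below : ∀ i → i < suc j → Heavy (iter parent i p)
    heavy-below zero    _           = hp
    heavy-below (suc i) (s≤s i<j) =
      subst Heavy (sym (iter-suc parent i p)) (below i i<j)

  sp-on-path : ∀ k p → Light (iter parent k p) →
               ¬ ¬ (∃₂ λ s i → IsSp p s × i ≤ k × iter parent i s ≡ iter parent k p)
  sp-on-path zero    p lp ¬sp = ¬sp (p , 0 , (0 , refl , lp , λ _ ()) , z≤n , refl)
  sp-on-path (suc k) p lk ¬sp = ¬¬-excluded-middle λ where
    (no  lp) → ¬sp (p , suc k , (0 , refl , lp , λ _ ()) , ≤-refl , refl)
    (yes hp) → sp-on-path k (parent p) (subst Light (iter-suc parent k p) lk) λ where
      (s , i , sp , i≤k , s↑i≡) → ¬sp (s , i , sp-of-heavy hp sp , m≤n⇒m≤1+n i≤k ,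
                                        trans s↑i≡ (sym (iter-suc parent k p)))

  nested-below-light :
    ∀ {a ℓ} {A : Set a} (S : Fin n → Pred A ℓ) → (∀ w x → Dec (S w x)) →
    (∀ w s s′ → w ≢ root → IsSp w s → IsSp (parent w) s′ → S w ⊆ S s′) →
    ∀ {u} → Light u → ∀ k w → iter parent k w ≡ u → S w ⊆ S u
  nested-below-light S S? into-sp {u} lu = <-rec P step
    where
    P : ℕ → Set _
    P k = ∀ w → iter parent k w ≡ u → S w ⊆ S u

    step : ∀ k → (∀ {i} → i < k → P i) → P k
    step zero    _   w refl x∈w = x∈w
    step (suc k) rec w w↑≡u {x} x∈w with w ≟ root
    -- the root is a fixed point of parent, so here u is the root itself
    ... | yes refl =
      subst (λ z → S z x) (trans (sym (iter-fixed parent root parent-root (suc k))) w↑≡u) x∈w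
    -- otherwise S w ⊆ S (sp (parent w)), and sp (parent w) is i ≤ k steps below u
    ... | no w≢root =
      decidable-stable (S? u x) λ x∉u →
        sp-on-path (suc k) w (subst Light (sym w↑≡u) lu) λ where
          (s , _ , sp , _) → sp-on-path k (parent w) (subst Light (sym pw↑≡u) lu) λ where
            (s′ , i , sp′ , i≤k , s′↑i≡) →
              x∉u (rec (s≤s i≤k) s′ (trans s′↑i≡ pw↑≡u) (into-sp w s s′ w≢root sp sp′ x∈w))
      where
      pw↑≡u : iter parent k (parent w) ≡ u
      pw↑≡u = trans (sym (iter-suc parent k w)) w↑≡u

claim1 : {n : ℕ} (T : RootedTree n) (H : HeavyChoice T)
         (I : Fin n → ℤ × ℤ)
         → (∀ u → proj₁ (I u) ≤ℤ proj₂ (I u))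
         → (∀ u v → u ≢ v → ¬ ((⟪ I u ⟫ ⊆ ⟪ I v ⟫) × (⟪ I v ⟫ ⊆ ⟪ I u ⟫)))
         → (∀ u s s′ → u ≢ RootedTree.root T → HeavyChoice.IsSp H u s → HeavyChoice.IsSp H (RootedTree.parent T u) s′
            → ⟪ I u ⟫ ⊆ (⟪ I s ⟫ ∩ ⟪ I s′ ⟫))
         → ∀ u → HeavyChoice.Light H u → ∀ v → RootedTree.Descendant T v u
         → ⟪ I v ⟫ ⊂ ⟪ I u ⟫
claim1 T H I _ distinct inside-sps u lu v (u≢v , k , v↑k≡u) =
  v⊆u , λ u⊆v → distinct u v u≢v (u⊆v , v⊆u)
  where
  open Supervisor T H

  -- only the second half of the hypothesis, I(w) ⊆ I(sp(parent w)), is needed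
  v⊆u : ⟪ I v ⟫ ⊆ ⟪ I u ⟫
  v⊆u = nested-below-light (λ w → ⟪ I w ⟫) (λ w → interval? (I w))
          (λ w s s′ w≢root sp sp′ x∈w → proj₂ (inside-sps w s s′ w≢root sp sp′ x∈w))
          lu k v v↑k≡u
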